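{- Let $T=(\{0,\ldots,n-1\},E,\prec)$ be a mutual search algorithm that is not saturated. Then there exists a mutual search algorithm $T'$ on the $n+1$ sites $\{0,\ldots,n\}$ whose restriction to the sites $\{0,\ldots,n-1\}$ (arcs among them with the induced order) is $T$, and whose cost satisfies $c(T')\le c(T)$.
   Context: A deterministic synchronous mutual search (MS) algorithm for two agents on sites $V=\{0,\ldots,n-1\}$ is an ordered tournament $T=(V,E,\prec)$: $E$ contains, for each unordered pair $\{i,j\}$ of distinct sites, exactly one of the arcs $(i,j)$, $(j,i)$ (arc $(i,j)$: an agent at $i$ queries $j$), and $\prec$ is a total order on $E$ (time order). Row $E_i$ is the set of arcs leaving $i$ and $|E_i|$ is its length. The cost of an arc $e=(i,j)$ is $c(e)=|\{f\in E_i: f\prec e\}|+1+|\{f\in E_j: f\prec e\}|$, and the cost $c(T)$ is $\max_{e\in E}c(e)$. The algorithm is called saturated if its cost equals its maximum row length $\max_i |E_i|$. -}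

module Defs where

open import Data.Nat using (ℕ; zero; suc; _+_; _⊔_)
open import Data.Fin using (Fin; inject₁; fromℕ; _≟_)
open import Data.List using (List; []; _∷_; length; filter; map; foldr; allFin)
open import Data.List.Membership.Propositional using (_∈_; _∉_)
open import Data.List.Relation.Unary.Unique.Propositional using (Unique)
open import Data.Product using (_×_; _,_; proj₁; proj₂)
open import Data.Sum using (_⊎_)
open import Relation.Nullary using (¬_)
open import Relation.Nullary.Decidable using (¬?; _×-dec_)
open import Relation.Binary.PropositionalEquality using (_≡_; _≢_)

-- An arc (i , j): an agent at site i queries site j.
Arc : ℕ → Set
Arc n = Fin n × Fin n

-- An ordered tournament is given by the list of its arcs in time order
-- (a total order on the finite set E is the same as a repetition-free listing).
record IsTournament {n : ℕ} (arcs : List (Arc n)) : Set where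
  field
    distinct  : Unique arcs
    loopless  : ∀ {i j} → (i , j) ∈ arcs → i ≢ j
    covers    : ∀ (i j : Fin n) → i ≢ j → (i , j) ∈ arcs ⊎ (j , i) ∈ arcs
    antisym   : ∀ {i j} → (i , j) ∈ arcs → (j , i) ∉ arcs

record MSAlgorithm (n : ℕ) : Set where
  field
    arcs  : List (Arc n)
    valid : IsTournament arcs
open MSAlgorithm public

rowLen : {n : ℕ} → List (Arc n) → Fin n → ℕ
rowLen es i = length (filter (λ e → proj₁ e ≟ i) es)

costsFrom : {n : ℕ} → List (Arc n) → List (Arc n) → List ℕ
costsFrom prefix [] = []
costsFrom prefix ((i , j) ∷ es) =
  (rowLen prefix i + 1 + rowLen prefix j) ∷ costsFrom (prefix Data.List.++ ((i , j) ∷ [])) es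

maxList : List ℕ → ℕ
maxList = foldr _⊔_ 0

cost : {n : ℕ} → MSAlgorithm n → ℕ
cost T = maxList (costsFrom [] (arcs T))

maxRow : {n : ℕ} → MSAlgorithm n → ℕ
maxRow {n} T = maxList (map (rowLen (arcs T)) (allFin n))

Saturated : {n : ℕ} → MSAlgorithm n → Set
Saturated T = cost T ≡ maxRow T

injArc : {n : ℕ} → Arc n → Arc (suc n)
injArc (i , j) = inject₁ i , inject₁ j

restrict : {n : ℕ} → List (Arc (suc n)) → List (Arc (suc n))
restrict {n} = filter (λ e → ¬? (proj₁ e ≟ fromℕ n) ×-dec ¬? (proj₂ e ≟ fromℕ n))

-- Add the new site n as a sink that every old site queries, after all old arcs. Old arcs keep
-- their costs, and since n never queries, the new arc (i , n) costs |E_i| + 1. The last arc of a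
-- row always costs at least its length, so c(T) ≥ max_i |E_i|; non-saturation makes this strict,
-- hence |E_i| + 1 ≤ c(T) for every i.
module Submission where

open import Defs
open import Data.Nat using (ℕ; suc; z≤n; s≤s; _≤_; _+_; _⊔_)
open import Data.Nat.Properties
  using (≤-refl; ≤-trans; +-comm; +-identityʳ; m≤m+n; ⊔-lub; ⊔-assoc; m≤m⊔n; m≤n⊔m; ≤∧≢⇒<;
         module ≤-Reasoning)
open import Data.Fin using (Fin; inject₁; fromℕ; _≟_)
open import Data.Fin.Properties using (fromℕ≢inject₁; inject₁-injective)
open import Data.Fin.Relation.Unary.Top using (view; ‵fromℕ; ‵inject₁)
open import Data.List using (List; []; _∷_; [_]; _++_; map; allFin; filter; length)
open import Data.List.Properties
  using (++-assoc; ++-identityʳ; length-++; filter-++; filter-all; filter-none; map-++; map-∘; map-cong-local)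
open import Data.List.Relation.Unary.All as All using (All; []; _∷_)
import Data.List.Relation.Unary.All.Properties as All
open import Data.List.Relation.Unary.AllPairs using ([]; _∷_)
open import Data.List.Relation.Unary.Unique.Propositional using (Unique)
import Data.List.Relation.Unary.Unique.Propositional.Properties as Unique
open import Data.List.Membership.Propositional using (_∈_; _∉_)
open import Data.List.Membership.Propositional.Properties
  using (∈-map⁺; ∈-map⁻; ∈-++⁺ˡ; ∈-++⁺ʳ; ∈-++⁻; ∈-allFin)
open import Data.Product using (Σ; _×_; _,_; proj₁; proj₂)
open import Data.Sum using (_⊎_; inj₁; inj₂)
open import Data.Empty using (⊥-elim)
open import Function using (_∘_)
open import Function.Definitions using (Injective)
open import Relation.Nullary using (¬_; yes; no)
open import Relation.Binary.PropositionalEquality using (_≡_; _≢_; refl; sym; trans; cong; cong₂; subst; module ≡-Reasoning)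

maxList-lub : ∀ {c} {xs : List ℕ} → All (_≤ c) xs → maxList xs ≤ c
maxList-lub []           = z≤n
maxList-lub (x≤c ∷ xs≤c) = ⊔-lub x≤c (maxList-lub xs≤c)

maxList-upper : (xs : List ℕ) → All (_≤ maxList xs) xs
maxList-upper []       = []
maxList-upper (x ∷ xs) = m≤m⊔n x _ ∷ All.map (λ y≤ → ≤-trans y≤ (m≤n⊔m x _)) (maxList-upper xs)

maxList-++ : (xs ys : List ℕ) → maxList (xs ++ ys) ≡ maxList xs ⊔ maxList ys
maxList-++ []       ys = refl
maxList-++ (x ∷ xs) ys = trans (cong (x ⊔_) (maxList-++ xs ys)) (sym (⊔-assoc x _ _))

module _ {n : ℕ} where

  rowLen-++ : (p q : List (Arc n)) (x : Fin n) → rowLen (p ++ q) x ≡ rowLen p x + rowLen q x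
  rowLen-++ p q x = trans (cong length (filter-++ (λ e → proj₁ e ≟ x) p q)) (length-++ (filter _ p))

  rowLen-singleton-≢ : ∀ {a b x : Fin n} → a ≢ x → rowLen [ a , b ] x ≡ 0
  rowLen-singleton-≢ {a} {b} {x} a≢x with a ≟ x
  ... | yes a≡x = ⊥-elim (a≢x a≡x)
  ... | no _    = refl

  rowLen-singleton-≡ : ∀ {a b : Fin n} → rowLen [ a , b ] a ≡ 1
  rowLen-singleton-≡ {a} with a ≟ a
  ... | yes _   = refl
  ... | no a≢a = ⊥-elim (a≢a refl)

  rowLen-snoc-≢ : ∀ (p : List (Arc n)) {a b x} → a ≢ x → rowLen (p ++ [ a , b ]) x ≡ rowLen p x
  rowLen-snoc-≢ p {a} {b} {x} a≢x = begin
    rowLen (p ++ [ a , b ]) x       ≡⟨ rowLen-++ p [ a , b ] x ⟩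
    rowLen p x + rowLen [ a , b ] x ≡⟨ cong (rowLen p x +_) (rowLen-singleton-≢ a≢x) ⟩
    rowLen p x + 0                  ≡⟨ +-identityʳ _ ⟩
    rowLen p x                      ∎
    where open ≡-Reasoning

  costsFrom-++ : (p xs ys : List (Arc n)) →
                 costsFrom p (xs ++ ys) ≡ costsFrom p xs ++ costsFrom (p ++ xs) ys
  costsFrom-++ p []       ys = cong (λ q → costsFrom q ys) (sym (++-identityʳ p))
  costsFrom-++ p (e ∷ xs) ys = cong (_ ∷_) (begin
    costsFrom (p ++ [ e ]) (xs ++ ys)
      ≡⟨ costsFrom-++ (p ++ [ e ]) xs ys ⟩
    costsFrom (p ++ [ e ]) xs ++ costsFrom ((p ++ [ e ]) ++ xs) ys
      ≡⟨ cong (λ q → costsFrom (p ++ [ e ]) xs ++ costsFrom q ys) (++-assoc p [ e ] xs) ⟩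
    costsFrom (p ++ [ e ]) xs ++ costsFrom (p ++ e ∷ xs) ys ∎)
    where open ≡-Reasoning

  -- The last arc leaving x costs at least the length of row x.
  rowLen-≤-costs : ∀ {c} (p es : List (Arc n)) (x : Fin n) →
                   rowLen p x ≤ c → All (_≤ c) (costsFrom p es) → rowLen (p ++ es) x ≤ c
  rowLen-≤-costs {c} p [] x p≤c [] = subst (λ q → rowLen q x ≤ c) (sym (++-identityʳ p)) p≤c
  rowLen-≤-costs {c} p ((a , b) ∷ es) x p≤c (ab≤c ∷ es≤c) =
    subst (λ q → rowLen q x ≤ c) (++-assoc p [ a , b ] es)
      (rowLen-≤-costs (p ++ [ a , b ]) es x snoc≤c es≤c)
    where
    snoc≤c : rowLen (p ++ [ a , b ]) x ≤ c
    snoc≤c with a ≟ x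
    ... | no a≢x   = subst (_≤ c) (sym (rowLen-snoc-≢ p a≢x)) p≤c
    ... | yes refl = begin
      rowLen (p ++ [ a , b ]) a             ≡⟨ rowLen-++ p [ a , b ] a ⟩
      rowLen p a + rowLen [ a , b ] a       ≡⟨ cong (rowLen p a +_) (rowLen-singleton-≡ {a} {b}) ⟩
      rowLen p a + 1                        ≤⟨ m≤m+n _ _ ⟩
      rowLen p a + 1 + rowLen p b           ≤⟨ ab≤c ⟩
      c                                     ∎
      where open ≤-Reasoning

  rowLen-≤-cost : (T : MSAlgorithm n) (x : Fin n) → rowLen (arcs T) x ≤ cost T
  rowLen-≤-cost T x = rowLen-≤-costs [] (arcs T) x z≤n (maxList-upper _)

  maxRow-≤-cost : (T : MSAlgorithm n) → maxRow T ≤ cost T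
  maxRow-≤-cost T = maxList-lub (All.map⁺ (All.universal (rowLen-≤-cost T) (allFin n)))

  rowLen+1-≤-cost : (T : MSAlgorithm n) → ¬ Saturated T → (x : Fin n) → rowLen (arcs T) x + 1 ≤ cost T
  rowLen+1-≤-cost T unsaturated x = begin
    rowLen (arcs T) x + 1 ≡⟨ +-comm _ 1 ⟩
    suc (rowLen (arcs T) x) ≤⟨ s≤s row≤maxRow ⟩
    suc (maxRow T)          ≤⟨ ≤∧≢⇒< (maxRow-≤-cost T) (unsaturated ∘ sym) ⟩
    cost T                  ∎
    where
    open ≤-Reasoning
    row≤maxRow : rowLen (arcs T) x ≤ maxRow T
    row≤maxRow = All.lookup (maxList-upper _) (∈-map⁺ (rowLen (arcs T)) (∈-allFin x))

relabel : ∀ {m n} → (Fin m → Fin n) → Arc m → Arc n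
relabel f (i , j) = f i , f j

rowLen-relabel-∉ : ∀ {m n} {f : Fin m → Fin n} {x : Fin n} → (∀ k → f k ≢ x) →
                   (p : List (Arc m)) → rowLen (map (relabel f) p) x ≡ 0
rowLen-relabel-∉ x∉f []                         = refl
rowLen-relabel-∉ {f = f} {x} x∉f ((a , b) ∷ p) with f a ≟ x
... | yes fa≡x = ⊥-elim (x∉f a fa≡x)
... | no _     = rowLen-relabel-∉ x∉f p

module _ {m n : ℕ} {f : Fin m → Fin n} (f-injective : Injective _≡_ _≡_ f) where

  relabel-injective : Injective _≡_ _≡_ (relabel f)
  relabel-injective {i , j} {k , l} eq =
    cong₂ _,_ (f-injective (cong proj₁ eq)) (f-injective (cong proj₂ eq))

  rowLen-relabel : (p : List (Arc m)) (x : Fin m) → rowLen (map (relabel f) p) (f x) ≡ rowLen p x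
  rowLen-relabel []            x = refl
  rowLen-relabel ((a , b) ∷ p) x with f a ≟ f x | a ≟ x
  ... | yes _      | yes _    = cong suc (rowLen-relabel p x)
  ... | no _       | no _     = rowLen-relabel p x
  ... | yes fa≡fx | no a≢x   = ⊥-elim (a≢x (f-injective fa≡fx))
  ... | no fa≢fx  | yes a≡x  = ⊥-elim (fa≢fx (cong f a≡x))

  costsFrom-relabel : (p es : List (Arc m)) →
                      costsFrom (map (relabel f) p) (map (relabel f) es) ≡ costsFrom p es
  costsFrom-relabel p []            = refl
  costsFrom-relabel p ((a , b) ∷ es) = cong₂ _∷_
    (cong₂ (λ u v → u + 1 + v) (rowLen-relabel p a) (rowLen-relabel p b))
    (trans (cong (λ q → costsFrom q (map (relabel f) es)) (sym (map-++ (relabel f) p [ a , b ])))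
           (costsFrom-relabel (p ++ [ a , b ]) es))

costsFrom-sink : ∀ {n} {x : Fin n} (p : List (Arc n)) (ks : List (Fin n)) →
                 Unique ks → All (_≢ x) ks → rowLen p x ≡ 0 →
                 costsFrom p (map (_, x) ks) ≡ map (λ k → rowLen p k + 1) ks
costsFrom-sink p [] _ _ _ = refl
costsFrom-sink {x = x} p (k ∷ ks) (k∉ks ∷ ks-unique) (k≢x ∷ ks≢x) x-silent = cong₂ _∷_
  (trans (cong (rowLen p k + 1 +_) x-silent) (+-identityʳ _))
  (trans (costsFrom-sink (p ++ [ k , x ]) ks ks-unique ks≢x (trans (rowLen-snoc-≢ p k≢x) x-silent))
         (map-cong-local (All.map (λ k≢k′ → cong (_+ 1) (rowLen-snoc-≢ p k≢k′)) k∉ks)))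

module Extension {n : ℕ} (T : MSAlgorithm n) where
  open IsTournament (valid T)

  top : Fin (suc n)
  top = fromℕ n

  inject₁≢top : ∀ {k : Fin n} → inject₁ k ≢ top
  inject₁≢top = fromℕ≢inject₁ ∘ sym

  sources : List (Fin (suc n))
  sources = map inject₁ (allFin n)

  old new : List (Arc (suc n))
  old = map (relabel inject₁) (arcs T)
  new = map (_, top) sources

  arcs′ : List (Arc (suc n))
  arcs′ = old ++ new

  old-avoids-top : All (λ e → proj₁ e ≢ top × proj₂ e ≢ top) old
  old-avoids-top = All.map⁺ (All.universal (λ _ → inject₁≢top , inject₁≢top) (arcs T))

  new-into-top : All (λ e → proj₁ e ≢ top × proj₂ e ≡ top) new
  new-into-top = All.map⁺ (All.map⁺ (All.universal (λ _ → inject₁≢top , refl) (allFin n)))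

  ∈-old⁺ : ∀ {a b} → (a , b) ∈ arcs T → (inject₁ a , inject₁ b) ∈ arcs′
  ∈-old⁺ ab∈T = ∈-++⁺ˡ (∈-map⁺ (relabel inject₁) ab∈T)

  ∈-new⁺ : ∀ k → (inject₁ k , top) ∈ arcs′
  ∈-new⁺ k = ∈-++⁺ʳ old (∈-map⁺ (_, top) (∈-map⁺ inject₁ (∈-allFin k)))

  ∈-old⁻ : ∀ {a b} → (inject₁ a , inject₁ b) ∈ arcs′ → (a , b) ∈ arcs T
  ∈-old⁻ ab∈ with ∈-++⁻ old ab∈
  ... | inj₁ ab∈old with ∈-map⁻ (relabel inject₁) ab∈old
  ...   | e , e∈T , eq = subst (_∈ arcs T) (sym (relabel-injective inject₁-injective eq)) e∈T
  ∈-old⁻ ab∈ | inj₂ ab∈new = ⊥-elim (inject₁≢top (proj₂ (All.lookup new-into-top ab∈new)))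

  top-∉ : ∀ {j} → (top , j) ∉ arcs′
  top-∉ tj∈ with ∈-++⁻ old tj∈
  ... | inj₁ tj∈old = proj₁ (All.lookup old-avoids-top tj∈old) refl
  ... | inj₂ tj∈new = proj₁ (All.lookup new-into-top tj∈new) refl

  distinct′ : Unique arcs′
  distinct′ = Unique.++⁺
    (Unique.map⁺ (relabel-injective inject₁-injective) distinct)
    (Unique.map⁺ (cong proj₁) (Unique.map⁺ inject₁-injective (Unique.allFin⁺ n)))
    (λ (e∈old , e∈new) → proj₂ (All.lookup old-avoids-top e∈old) (proj₂ (All.lookup new-into-top e∈new)))

  loopless′ : ∀ {i j} → (i , j) ∈ arcs′ → i ≢ j
  loopless′ {i} ii∈ refl with view i
  ... | ‵fromℕ     = top-∉ ii∈
  ... | ‵inject₁ k = loopless (∈-old⁻ ii∈) refl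

  covers′ : ∀ i j → i ≢ j → (i , j) ∈ arcs′ ⊎ (j , i) ∈ arcs′
  covers′ i j i≢j with view i | view j
  ... | ‵fromℕ     | ‵fromℕ     = ⊥-elim (i≢j refl)
  ... | ‵fromℕ     | ‵inject₁ k = inj₂ (∈-new⁺ k)
  ... | ‵inject₁ k | ‵fromℕ     = inj₁ (∈-new⁺ k)
  ... | ‵inject₁ a | ‵inject₁ b with covers a b (i≢j ∘ cong inject₁)
  ...   | inj₁ ab∈T = inj₁ (∈-old⁺ ab∈T)
  ...   | inj₂ ba∈T = inj₂ (∈-old⁺ ba∈T)

  antisym′ : ∀ {i j} → (i , j) ∈ arcs′ → (j , i) ∉ arcs′
  antisym′ {i} {j} ij∈ ji∈ with view i | view j
  ... | ‵fromℕ     | _          = top-∉ ij∈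
  ... | ‵inject₁ _ | ‵fromℕ     = top-∉ ji∈
  ... | ‵inject₁ a | ‵inject₁ b = antisym (∈-old⁻ ij∈) (∈-old⁻ ji∈)

  extend : MSAlgorithm (suc n)
  extend = record
    { arcs  = arcs′
    ; valid = record { distinct = distinct′ ; loopless = loopless′ ; covers = covers′ ; antisym = antisym′ }
    }

  restrict-extend : restrict (arcs extend) ≡ map injArc (arcs T)
  restrict-extend = begin
    restrict (old ++ new)       ≡⟨ filter-++ _ old new ⟩
    restrict old ++ restrict new ≡⟨ cong₂ _++_ (filter-all _ old-avoids-top)
                                              (filter-none _ (All.map (λ e∈ (_ , e≢top) → e≢top (proj₂ e∈)) new-into-top)) ⟩
    old ++ []                    ≡⟨ ++-identityʳ old ⟩
    old                          ∎
    where open ≡-Reasoning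

  cost-extend : cost extend ≡ cost T ⊔ maxList (map (λ k → rowLen (arcs T) k + 1) (allFin n))
  cost-extend = begin
    maxList (costsFrom [] (old ++ new))
      ≡⟨ cong maxList (costsFrom-++ [] old new) ⟩
    maxList (costsFrom [] old ++ costsFrom old new)
      ≡⟨ maxList-++ (costsFrom [] old) (costsFrom old new) ⟩
    maxList (costsFrom [] old) ⊔ maxList (costsFrom old new)
      ≡⟨ cong₂ (λ xs ys → maxList xs ⊔ maxList ys) (costsFrom-relabel inject₁-injective [] (arcs T)) costs-new ⟩
    cost T ⊔ maxList (map (λ k → rowLen (arcs T) k + 1) (allFin n)) ∎
    where
    open ≡-Reasoning
    costs-new : costsFrom old new ≡ map (λ k → rowLen (arcs T) k + 1) (allFin n)
    costs-new = begin
      costsFrom old (map (_, top) sources)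
        ≡⟨ costsFrom-sink old sources (Unique.map⁺ inject₁-injective (Unique.allFin⁺ n))
             (All.map⁺ (All.universal (λ _ → inject₁≢top) (allFin n)))
             (rowLen-relabel-∉ (λ _ → inject₁≢top) (arcs T)) ⟩
      map (λ k → rowLen old k + 1) (map inject₁ (allFin n))
        ≡⟨ sym (map-∘ (allFin n)) ⟩
      map (λ k → rowLen old (inject₁ k) + 1) (allFin n)
        ≡⟨ map-cong-local (All.universal (λ k → cong (_+ 1) (rowLen-relabel inject₁-injective (arcs T) k)) (allFin n)) ⟩
      map (λ k → rowLen (arcs T) k + 1) (allFin n) ∎

lemma3 : (n : ℕ) (T : MSAlgorithm n) → ¬ Saturated T →
    Σ (MSAlgorithm (suc n)) (λ T' →
      (restrict (arcs T') ≡ map injArc (arcs T)) × (cost T' ≤ cost T))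
lemma3 n T unsaturated = extend , restrict-extend , cost-extend≤cost
  where
  open Extension T
  cost-extend≤cost : cost extend ≤ cost T
  cost-extend≤cost = subst (_≤ cost T) (sym cost-extend)
    (⊔-lub ≤-refl (maxList-lub (All.map⁺ (All.universal (rowLen+1-≤-cost T unsaturated) (allFin n)))))
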